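{- Let $q$ be an odd prime power. No two proper conics in $PG(2,q)$ which intersect in exactly one point are simultaneously diagonalizable.
   Context: $PG(2,q)$ is the projective plane over $GF(q)$. A conic is the zero set $\mathbb{V}(E)$ in $PG(2,q)$ of a nonzero quadratic form $E=ax^2+by^2+cz^2+dxy+exz+fyz$ over $GF(q)$; it is proper if its symmetric matrix (diagonal $2a,2b,2c$, off-diagonal $d,e,f$) is nonsingular. Two conics $\mathbb{V}(E_1),\mathbb{V}(E_2)$ are simultaneously diagonalizable if there is an invertible $3\times3$ matrix $S$ over $GF(q)$ such that both forms $v\mapsto E_1(Sv)$ and $v\mapsto E_2(Sv)$ have zero coefficients of $xy,xz,yz$. -}

module Defs where

open import Level using (Level; _⊔_)
open import Algebra.Bundles using (CommutativeRing)
open import Data.Fin using (Fin; zero; suc)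
open import Data.List using (List)
open import Data.List.Relation.Unary.Any using (Any)
open import Data.Product using (Σ; ∃; _×_; _,_)
open import Relation.Nullary using (¬_)

module _ {c ℓ : Level} (R : CommutativeRing c ℓ) where
  open CommutativeRing R using (Carrier; _≈_; _+_; _*_; _-_; 0#; 1#)

  IsField : Set (c ⊔ ℓ)
  IsField = (¬ (1# ≈ 0#)) × (∀ x → ¬ (x ≈ 0#) → ∃ λ y → x * y ≈ 1#)

  IsFinite : Set (c ⊔ ℓ)
  IsFinite = Σ (List Carrier) λ xs → ∀ x → Any (λ y → x ≈ y) xs

  -- a finite field has odd order q iff its characteristic is not 2
  OddCharacteristic : Set ℓ
  OddCharacteristic = ¬ ((1# + 1#) ≈ 0#)

  Vec3 : Set c
  Vec3 = Fin 3 → Carrier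

  Mat3 : Set c
  Mat3 = Fin 3 → Fin 3 → Carrier

  x₀ y₀ z₀ : Vec3 → Carrier
  x₀ v = v zero
  y₀ v = v (suc zero)
  z₀ v = v (suc (suc zero))

  IsZeroVec : Vec3 → Set ℓ
  IsZeroVec v = ∀ i → v i ≈ 0#

  record QForm : Set c where
    constructor qform
    field
      a b c' d e f : Carrier

  NonZeroForm : QForm → Set ℓ
  NonZeroForm (qform a b c' d e f) =
    ¬ ((a ≈ 0#) × (b ≈ 0#) × (c' ≈ 0#) × (d ≈ 0#) × (e ≈ 0#) × (f ≈ 0#))

  eval : QForm → Vec3 → Carrier
  eval (qform a b c' d e f) v =
    a * (x * x) + b * (y * y) + c' * (z * z) + d * (x * y) + e * (x * z) + f * (y * z)
    where
      x = x₀ v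
      y = y₀ v
      z = z₀ v

  det3 : Mat3 → Carrier
  det3 M =
      M i0 i0 * (M i1 i1 * M i2 i2 - M i1 i2 * M i2 i1)
    - M i0 i1 * (M i1 i0 * M i2 i2 - M i1 i2 * M i2 i0)
    + M i0 i2 * (M i1 i0 * M i2 i1 - M i1 i1 * M i2 i0)
    where
      i0 i1 i2 : Fin 3
      i0 = zero
      i1 = suc zero
      i2 = suc (suc zero)

  symMat : QForm → Mat3
  symMat (qform a b c' d e f) zero zero = a + a
  symMat (qform a b c' d e f) zero (suc zero) = d
  symMat (qform a b c' d e f) zero (suc (suc zero)) = e
  symMat (qform a b c' d e f) (suc zero) zero = d
  symMat (qform a b c' d e f) (suc zero) (suc zero) = b + b
  symMat (qform a b c' d e f) (suc zero) (suc (suc zero)) = f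
  symMat (qform a b c' d e f) (suc (suc zero)) zero = e
  symMat (qform a b c' d e f) (suc (suc zero)) (suc zero) = f
  symMat (qform a b c' d e f) (suc (suc zero)) (suc (suc zero)) = c' + c'

  Proper : QForm → Set ℓ
  Proper E = ¬ (det3 (symMat E) ≈ 0#)

  OnConic : QForm → Vec3 → Set ℓ
  OnConic E v = eval E v ≈ 0#

  SamePoint : Vec3 → Vec3 → Set (c ⊔ ℓ)
  SamePoint v p = ∃ λ t → ∀ i → v i ≈ t * p i

  MeetInExactlyOnePoint : QForm → QForm → Set (c ⊔ ℓ)
  MeetInExactlyOnePoint E₁ E₂ =
    Σ Vec3 λ p → (¬ IsZeroVec p) × OnConic E₁ p × OnConic E₂ p ×
      (∀ v → ¬ IsZeroVec v → OnConic E₁ v → OnConic E₂ v → SamePoint v p)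

  _·ₘ_ : Mat3 → Mat3 → Mat3
  (A ·ₘ B) i k = A i zero * B zero k + A i (suc zero) * B (suc zero) k
               + A i (suc (suc zero)) * B (suc (suc zero)) k

  I₃ : Mat3
  I₃ zero zero = 1#
  I₃ (suc zero) (suc zero) = 1#
  I₃ (suc (suc zero)) (suc (suc zero)) = 1#
  I₃ _ _ = 0#

  Invertible : Mat3 → Set (c ⊔ ℓ)
  Invertible S = ∃ λ T → (∀ i j → (S ·ₘ T) i j ≈ I₃ i j) × (∀ i j → (T ·ₘ S) i j ≈ I₃ i j)

  _·ᵥ_ : Mat3 → Vec3 → Vec3
  (S ·ᵥ v) i = S i zero * v zero + S i (suc zero) * v (suc zero) + S i (suc (suc zero)) * v (suc (suc zero))

  e₁ e₂ e₃ : Vec3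
  e₁ = λ i → I₃ zero i
  e₂ = λ i → I₃ (suc zero) i
  e₃ = λ i → I₃ (suc (suc zero)) i

  _+ᵥ_ : Vec3 → Vec3 → Vec3
  (u +ᵥ v) i = u i + v i

  -- coefficients of xy, xz, yz of the quadratic form Q(v) = a x² + ... + f yz,
  -- recovered from the function Q as Q(eᵢ+eⱼ) - Q(eᵢ) - Q(eⱼ)
  -- (exactly the coefficient of the mixed monomial, in any characteristic)
  mixedCoeff : (Vec3 → Carrier) → Vec3 → Vec3 → Carrier
  mixedCoeff Q u w = Q (u +ᵥ w) - Q u - Q w

  Diagonal : (Vec3 → Carrier) → Set ℓ
  Diagonal Q = (mixedCoeff Q e₁ e₂ ≈ 0#) × (mixedCoeff Q e₁ e₃ ≈ 0#) × (mixedCoeff Q e₂ e₃ ≈ 0#)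

  SimultaneouslyDiagonalizable : QForm → QForm → Set (c ⊔ ℓ)
  SimultaneouslyDiagonalizable E₁ E₂ =
    ∃ λ S → Invertible S × Diagonal (λ v → eval E₁ (S ·ᵥ v)) × Diagonal (λ v → eval E₂ (S ·ᵥ v))

module Submission where

-- After the change of coordinates v = S w both forms become diagonal, α x² + β y² + γ z².
-- The first stays proper, since its symmetric matrix becomes Sᵀ M S with determinant det(S)² det(M),
-- so α β γ ≠ 0; and the two conics still meet in exactly one point w.  A diagonal form is invariant
-- under changing the sign of a coordinate, so w is proportional to each of its sign changes; in odd
-- characteristic this forces x y = x z = y z = 0.  Then x² (α x² + β y² + γ z²) = α x⁴ and its
-- analogues force w = 0, which is not a point.

open import Defs
open import Level using (Level; 0ℓ; _⊔_)
open import Algebra.Bundles using (CommutativeRing; RawRing)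
open import Algebra.Morphism.Structures using (IsRingMonomorphism)
import Algebra.Morphism.RingMonomorphism as RingMonomorphism
import Algebra.Construct.Pointwise as Pointwise
open import Algebra.Solver.Ring.AlmostCommutativeRing
  using (fromCommutativeRing; _-Raw-AlmostCommutative⟶_)
open import Data.Fin using (Fin)
open import Data.Fin.Patterns using (0F; 1F; 2F)
open import Data.Integer as ℤ using (ℤ; +_; -[1+_]; _⊖_; _◃_; sign; ∣_∣)
import Data.Integer.Properties as ℤ
import Data.Maybe as Maybe
open import Data.Nat as ℕ using (ℕ; zero; suc)
import Data.Nat.Properties as ℕ
open import Data.Product using (_,_; ∃; proj₁; proj₂)
open import Data.Sign as Sign using (Sign)
open import Data.Vec using (Vec)
open import Function using (id; _∘_)
open import Relation.Binary.Consequences using (dec⇒weaklyDec)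
import Relation.Binary.PropositionalEquality as ≡
open import Relation.Nullary using (¬_)

module IntegerCoefficients {c ℓ : Level} (R : CommutativeRing c ℓ) where
  open CommutativeRing R
  open import Algebra.Properties.Ring ring using (-0#≈0#; -‿involutive; -1*x≈-x)
  open import Algebra.Properties.AbelianGroup +-abelianGroup using (xyx⁻¹≈y; ⁻¹-∙-comm)
  open import Algebra.Properties.CommutativeSemigroup *-commutativeSemigroup using (interchange)
  open import Algebra.Properties.Semiring.Mult.TCOptimised semiring using (_×_; 1+×; ×-homo-+; ×1-homo-*)
  open import Relation.Binary.Reasoning.Setoid setoid

  ⟦_⟧ᶻ : ℤ → Carrier
  ⟦ + n ⟧ᶻ = n × 1#
  ⟦ -[1+ n ] ⟧ᶻ = - (suc n × 1#)

  ⊖-+-homo : ∀ m n → ⟦ m ⊖ n ⟧ᶻ + n × 1# ≈ m × 1#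
  ⊖-+-homo m zero = +-identityʳ _
  ⊖-+-homo zero (suc n) = -‿inverseˡ _
  ⊖-+-homo (suc m) (suc n) = begin
    ⟦ suc m ⊖ suc n ⟧ᶻ + suc n × 1#  ≡⟨ ≡.cong (λ i → ⟦ i ⟧ᶻ + suc n × 1#) (ℤ.[1+m]⊖[1+n]≡m⊖n m n) ⟩
    ⟦ m ⊖ n ⟧ᶻ + suc n × 1#          ≈⟨ +-congˡ (1+× n 1#) ⟩
    ⟦ m ⊖ n ⟧ᶻ + (1# + n × 1#)       ≈⟨ +-congˡ (+-comm _ _) ⟩
    ⟦ m ⊖ n ⟧ᶻ + (n × 1# + 1#)       ≈⟨ +-assoc _ _ _ ⟨
    ⟦ m ⊖ n ⟧ᶻ + n × 1# + 1#         ≈⟨ +-congʳ (⊖-+-homo m n) ⟩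
    m × 1# + 1#                      ≈⟨ +-comm _ _ ⟩
    1# + m × 1#                      ≈⟨ 1+× m 1# ⟨
    suc m × 1#                       ∎

  ⊖-homo : ∀ m n → ⟦ m ⊖ n ⟧ᶻ ≈ m × 1# - n × 1#
  ⊖-homo m n = begin
    ⟦ m ⊖ n ⟧ᶻ                      ≈⟨ xyx⁻¹≈y (n × 1#) _ ⟨
    n × 1# + ⟦ m ⊖ n ⟧ᶻ - n × 1#    ≈⟨ +-congʳ (trans (+-comm _ _) (⊖-+-homo m n)) ⟩
    m × 1# - n × 1#                 ∎

  +-homo : ∀ i j → ⟦ i ℤ.+ j ⟧ᶻ ≈ ⟦ i ⟧ᶻ + ⟦ j ⟧ᶻ
  +-homo (+ m) (+ n) = ×-homo-+ 1# m n
  +-homo (+ m) -[1+ n ] = ⊖-homo m (suc n)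
  +-homo -[1+ m ] (+ n) = trans (⊖-homo n (suc m)) (+-comm _ _)
  +-homo -[1+ m ] -[1+ n ] = begin
    - (suc (suc m ℕ.+ n) × 1#)            ≡⟨ ≡.cong (λ k → - (suc k × 1#)) (ℕ.+-suc m n) ⟨
    - ((suc m ℕ.+ suc n) × 1#)            ≈⟨ -‿cong (×-homo-+ 1# (suc m) (suc n)) ⟩
    - (suc m × 1# + suc n × 1#)           ≈⟨ ⁻¹-∙-comm _ _ ⟨
    - (suc m × 1#) + - (suc n × 1#)       ∎

  signed : Sign → Carrier
  signed Sign.+ = 1#
  signed Sign.- = - 1#

  ◃-homo : ∀ s n → ⟦ s ◃ n ⟧ᶻ ≈ signed s * n × 1#
  ◃-homo s zero = sym (zeroʳ _)
  ◃-homo Sign.+ (suc n) = sym (*-identityˡ _)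
  ◃-homo Sign.- (suc n) = sym (-1*x≈-x _)

  signed-homo : ∀ s t → signed (s Sign.* t) ≈ signed s * signed t
  signed-homo Sign.+ t = sym (*-identityˡ _)
  signed-homo Sign.- Sign.+ = sym (*-identityʳ _)
  signed-homo Sign.- Sign.- = sym (trans (-1*x≈-x _) (-‿involutive _))

  *-homo : ∀ i j → ⟦ i ℤ.* j ⟧ᶻ ≈ ⟦ i ⟧ᶻ * ⟦ j ⟧ᶻ
  *-homo i j = begin
    ⟦ sign i Sign.* sign j ◃ ∣ i ∣ ℕ.* ∣ j ∣ ⟧ᶻ
      ≈⟨ ◃-homo (sign i Sign.* sign j) (∣ i ∣ ℕ.* ∣ j ∣) ⟩
    signed (sign i Sign.* sign j) * (∣ i ∣ ℕ.* ∣ j ∣) × 1#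
      ≈⟨ *-cong (signed-homo (sign i) (sign j)) (×1-homo-* ∣ i ∣ ∣ j ∣) ⟩
    (signed (sign i) * signed (sign j)) * (∣ i ∣ × 1# * ∣ j ∣ × 1#)
      ≈⟨ interchange _ _ _ _ ⟩
    (signed (sign i) * ∣ i ∣ × 1#) * (signed (sign j) * ∣ j ∣ × 1#)
      ≈⟨ *-cong (◃-homo (sign i) ∣ i ∣) (◃-homo (sign j) ∣ j ∣) ⟨
    ⟦ sign i ◃ ∣ i ∣ ⟧ᶻ * ⟦ sign j ◃ ∣ j ∣ ⟧ᶻ
      ≡⟨ ≡.cong₂ (λ i j → ⟦ i ⟧ᶻ * ⟦ j ⟧ᶻ) (ℤ.◃-inverse i) (ℤ.◃-inverse j) ⟩
    ⟦ i ⟧ᶻ * ⟦ j ⟧ᶻ ∎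

  -‿homo : ∀ i → ⟦ ℤ.- i ⟧ᶻ ≈ - ⟦ i ⟧ᶻ
  -‿homo (+ zero) = sym -0#≈0#
  -‿homo (+ suc n) = refl
  -‿homo -[1+ n ] = sym (-‿involutive _)

  homomorphism : ℤ.+-*-rawRing -Raw-AlmostCommutative⟶ fromCommutativeRing R
  homomorphism = record
    { ⟦_⟧ = ⟦_⟧ᶻ ; +-homo = +-homo ; *-homo = *-homo ; -‿homo = -‿homo
    ; 0-homo = refl ; 1-homo = refl }

-- Integer-coefficient polynomials over R, identified when their evaluations agree, form a commutative
-- ring: evaluation embeds them into the ring of functions from environments to R.
module PolynomialRing {c ℓ : Level} (R : CommutativeRing c ℓ) where
  open CommutativeRing R using (reflexive; isCommutativeRing)
  open IntegerCoefficients R using (⟦_⟧ᶻ; homomorphism)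

  open import Algebra.Solver.Ring ℤ.+-*-rawRing (fromCommutativeRing R) homomorphism
    (λ i j → Maybe.map (reflexive ∘ ≡.cong ⟦_⟧ᶻ) (dec⇒weaklyDec ℤ._≟_ i j)) public

  module _ (n : ℕ) where
    private
      module Functions = CommutativeRing (Pointwise.commutativeRing (Vec (CommutativeRing.Carrier R) n) R)

    rawPolynomialRing : RawRing 0ℓ (c ⊔ ℓ)
    rawPolynomialRing = record
      { Carrier = Polynomial n
      ; _≈_ = λ p q → Functions._≈_ ⟦ p ⟧ ⟦ q ⟧
      ; _+_ = _:+_ ; _*_ = _:*_ ; -_ = :-_ ; 0# = con (+ 0) ; 1# = con (+ 1) }

    ⟦⟧-isRingMonomorphism : IsRingMonomorphism rawPolynomialRing Functions.rawRing ⟦_⟧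
    ⟦⟧-isRingMonomorphism = record
      { isRingHomomorphism = record
        { isSemiringHomomorphism = record
          { isNearSemiringHomomorphism = record
            { +-isMonoidHomomorphism = record
              { isMagmaHomomorphism = record
                { isRelHomomorphism = record { cong = id }
                ; homo = λ _ _ → Functions.refl }
              ; ε-homo = Functions.refl }
            ; *-homo = λ _ _ → Functions.refl }
          ; 1#-homo = Functions.refl }
        ; -‿homo = λ _ → Functions.refl }
      ; injective = id }

    polynomialRing : CommutativeRing 0ℓ (c ⊔ ℓ)
    polynomialRing = record
      { isCommutativeRing =
          RingMonomorphism.isCommutativeRing ⟦⟧-isRingMonomorphism Functions.isCommutativeRing }


module Forms {c ℓ : Level} (R : CommutativeRing c ℓ) where
  open CommutativeRing R using (Carrier; _≈_; _*_; -_; 0#)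
  open import Data.Product using (_×_)

  infixr 7 _⊙_ _•_
  infixl 8 _⊗_
  infix 4 _≋_

  _⊙_ : Mat3 R → Vec3 R → Vec3 R
  _⊙_ = _·ᵥ_ R

  _⊗_ : Mat3 R → Mat3 R → Mat3 R
  _⊗_ = _·ₘ_ R

  _•_ : Carrier → Vec3 R → Vec3 R
  (t • v) i = t * v i

  _≋_ : Vec3 R → Vec3 R → Set ℓ
  u ≋ v = ∀ i → u i ≈ v i

  vector : Carrier → Carrier → Carrier → Vec3 R
  vector x y z 0F = x
  vector x y z 1F = y
  vector x y z 2F = z

  matrix : (s₀₀ s₀₁ s₀₂ s₁₀ s₁₁ s₁₂ s₂₀ s₂₁ s₂₂ : Carrier) → Mat3 R
  matrix s₀₀ s₀₁ s₀₂ s₁₀ s₁₁ s₁₂ s₂₀ s₂₁ s₂₂ 0F = vector s₀₀ s₀₁ s₀₂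
  matrix s₀₀ s₀₁ s₀₂ s₁₀ s₁₁ s₁₂ s₂₀ s₂₁ s₂₂ 1F = vector s₁₀ s₁₁ s₁₂
  matrix s₀₀ s₀₁ s₀₂ s₁₀ s₁₁ s₁₂ s₂₀ s₂₁ s₂₂ 2F = vector s₂₀ s₂₁ s₂₂

  negateˣ negateʸ : Vec3 R → Vec3 R
  negateˣ v = vector (- v 0F) (v 1F) (v 2F)
  negateʸ v = vector (v 0F) (- v 1F) (v 2F)

  column : Mat3 R → Fin 3 → Vec3 R
  column S j i = S i j

  -- The form v ↦ E (S v): its coefficients are the values of E and of its polar form on the columns of S.
  pullback : QForm R → Mat3 R → QForm R
  pullback E S = qform (eval R E (column S 0F)) (eval R E (column S 1F)) (eval R E (column S 2F))
    (polar (column S 0F) (column S 1F)) (polar (column S 0F) (column S 2F)) (polar (column S 1F) (column S 2F))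
    where
    polar : Vec3 R → Vec3 R → Carrier
    polar = mixedCoeff R (eval R E)

  IsDiagonal : QForm R → Set ℓ
  IsDiagonal (qform _ _ _ d e f) = (d ≈ 0#) × (e ≈ 0#) × (f ≈ 0#)

  diagonalForm : Carrier → Carrier → Carrier → QForm R
  diagonalForm a b c = qform a b c 0# 0# 0#

  diagonalPart : QForm R → QForm R
  diagonalPart (qform a b c _ _ _) = diagonalForm a b c

module _ {c ℓ : Level} (F : CommutativeRing c ℓ) where
  open CommutativeRing F hiding (zero)
  open import Data.Product using (_×_)
  open import Algebra.Properties.Ring ring using (-0#≈0#; -‿involutive)
  open import Relation.Binary.Reasoning.Setoid setoid
  open PolynomialRing F using (solve; _:=_; _:+_; _:*_; _:-_; :-_; con; polynomialRing)
  open Forms F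

  private
    -- Evaluating the ring-generic definitions on polynomials yields the syntax that the solver normalises.
    module Symbolic (n : ℕ) where
      R : CommutativeRing 0ℓ (c ⊔ ℓ)
      R = polynomialRing n
      open Forms R public

  x≈0⇒x*y≈0 : ∀ {x} y → x ≈ 0# → x * y ≈ 0#
  x≈0⇒x*y≈0 y x≈0 = trans (*-congʳ x≈0) (zeroˡ y)

  y≈0⇒x*y≈0 : ∀ x {y} → y ≈ 0# → x * y ≈ 0#
  y≈0⇒x*y≈0 x y≈0 = trans (*-congˡ y≈0) (zeroʳ x)

  x*y≉0⇒x≉0 : ∀ {x y} → ¬ x * y ≈ 0# → ¬ x ≈ 0#
  x*y≉0⇒x≉0 x*y≉0 x≈0 = x*y≉0 (x≈0⇒x*y≈0 _ x≈0)

  x*y≉0⇒y≉0 : ∀ {x y} → ¬ x * y ≈ 0# → ¬ y ≈ 0#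
  x*y≉0⇒y≉0 x*y≉0 y≈0 = x*y≉0 (y≈0⇒x*y≈0 _ y≈0)

  x+x≉0⇒x≉0 : ∀ {x} → ¬ x + x ≈ 0# → ¬ x ≈ 0#
  x+x≉0⇒x≉0 x+x≉0 x≈0 = x+x≉0 (trans (+-cong x≈0 x≈0) (+-identityʳ 0#))

  sub-cong : ∀ {a b c d} → a ≈ b → c ≈ d → a - c ≈ b - d
  sub-cong a≈b c≈d = +-cong a≈b (-‿cong c≈d)

  -x≈0⇒x≈0 : ∀ {x} → - x ≈ 0# → x ≈ 0#
  -x≈0⇒x≈0 {x} -x≈0 = trans (sym (-‿involutive x)) (trans (-‿cong -x≈0) -0#≈0#)

  ⊙-congˡ : ∀ {A B} v → (∀ i j → A i j ≈ B i j) → A ⊙ v ≋ B ⊙ v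
  ⊙-congˡ v A≈B i = +-cong (+-cong (*-congʳ (A≈B i 0F)) (*-congʳ (A≈B i 1F))) (*-congʳ (A≈B i 2F))

  ⊙-congʳ : ∀ A {u v} → u ≋ v → A ⊙ u ≋ A ⊙ v
  ⊙-congʳ A u≋v i = +-cong (+-cong (*-congˡ (u≋v 0F)) (*-congˡ (u≋v 1F))) (*-congˡ (u≋v 2F))

  ⊙-zero : ∀ A {v} → IsZeroVec F v → IsZeroVec F (A ⊙ v)
  ⊙-zero A {v} v≈0 i = begin
    A i 0F * v 0F + A i 1F * v 1F + A i 2F * v 2F
      ≈⟨ +-cong (+-cong (y≈0⇒x*y≈0 _ (v≈0 0F)) (y≈0⇒x*y≈0 _ (v≈0 1F))) (y≈0⇒x*y≈0 _ (v≈0 2F)) ⟩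
    0# + 0# + 0#  ≈⟨ trans (+-identityʳ _) (+-identityʳ 0#) ⟩
    0#            ∎

  -- Component i only involves row i of A, so A is replaced by the matrix all of whose rows are that row.
  ⊙-assoc : ∀ A B v → A ⊙ (B ⊙ v) ≋ (A ⊗ B) ⊙ v
  ⊙-assoc A B v i = solve 15
    (λ r₀ r₁ r₂ b₀₀ b₀₁ b₀₂ b₁₀ b₁₁ b₁₂ b₂₀ b₂₁ b₂₂ x y z →
       let A = λ _ → ℙ.vector r₀ r₁ r₂
           B = ℙ.matrix b₀₀ b₀₁ b₀₂ b₁₀ b₁₁ b₁₂ b₂₀ b₂₁ b₂₂
           v = ℙ.vector x y z
       in (A ℙ.⊙ (B ℙ.⊙ v)) i := (A ℙ.⊗ B ℙ.⊙ v) i)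
    refl (A i 0F) (A i 1F) (A i 2F)
    (B 0F 0F) (B 0F 1F) (B 0F 2F) (B 1F 0F) (B 1F 1F) (B 1F 2F) (B 2F 0F) (B 2F 1F) (B 2F 2F)
    (v 0F) (v 1F) (v 2F)
    where module ℙ = Symbolic 15

  ⊙-• : ∀ A t v → A ⊙ (t • v) ≋ t • (A ⊙ v)
  ⊙-• A t v i = solve 7
    (λ r₀ r₁ r₂ t x y z →
       let A = λ _ → ℙ.vector r₀ r₁ r₂
           v = ℙ.vector x y z
       in (A ℙ.⊙ (t ℙ.• v)) i := (t ℙ.• (A ℙ.⊙ v)) i)
    refl (A i 0F) (A i 1F) (A i 2F) t (v 0F) (v 1F) (v 2F)
    where module ℙ = Symbolic 7

  I₃-⊙ : ∀ v → I₃ F ⊙ v ≋ v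
  I₃-⊙ v = λ where
      0F → solve 3 (λ x y z → (I₃ ℙ.R ℙ.⊙ ℙ.vector x y z) 0F := x) refl (v 0F) (v 1F) (v 2F)
      1F → solve 3 (λ x y z → (I₃ ℙ.R ℙ.⊙ ℙ.vector x y z) 1F := y) refl (v 0F) (v 1F) (v 2F)
      2F → solve 3 (λ x y z → (I₃ ℙ.R ℙ.⊙ ℙ.vector x y z) 2F := z) refl (v 0F) (v 1F) (v 2F)
    where module ℙ = Symbolic 3

  ⊙-inverse : ∀ S T → (∀ i j → (T ⊗ S) i j ≈ I₃ F i j) → ∀ v → T ⊙ (S ⊙ v) ≋ v
  ⊙-inverse S T T⊗S≈I v i = begin
    (T ⊙ (S ⊙ v)) i  ≈⟨ ⊙-assoc T S v i ⟩
    (T ⊗ S ⊙ v) i    ≈⟨ ⊙-congˡ v T⊗S≈I i ⟩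
    (I₃ F ⊙ v) i     ≈⟨ I₃-⊙ v i ⟩
    v i              ∎

  nonzero-⊙ : ∀ S T → (∀ u → T ⊙ (S ⊙ u) ≋ u) → ∀ {v} → ¬ IsZeroVec F v → ¬ IsZeroVec F (S ⊙ v)
  nonzero-⊙ S T TS≈id {v} v≉0 Sv≈0 = v≉0 λ i → trans (sym (TS≈id v i)) (⊙-zero T Sv≈0 i)

  SamePoint-⊙ : ∀ A {u v} → SamePoint F u v → SamePoint F (A ⊙ u) (A ⊙ v)
  SamePoint-⊙ A {v = v} (t , u≈tv) = t , λ i → trans (⊙-congʳ A u≈tv i) (⊙-• A t v i)

  SamePoint-congˡ : ∀ {u u′ p} → u′ ≋ u → SamePoint F u′ p → SamePoint F u p
  SamePoint-congˡ u′≋u (t , u′≈tp) = t , λ i → trans (sym (u′≋u i)) (u′≈tp i)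

  eval-cong : ∀ E {u v} → u ≋ v → eval F E u ≈ eval F E v
  eval-cong (qform a b c d e f) {u} {v} u≋v =
    +-cong (+-cong (+-cong (+-cong (+-cong (*-congˡ (square 0F)) (*-congˡ (square 1F)))
      (*-congˡ (square 2F))) (*-congˡ (*-cong (u≋v 0F) (u≋v 1F)))) (*-congˡ (*-cong (u≋v 0F) (u≋v 2F))))
      (*-congˡ (*-cong (u≋v 1F) (u≋v 2F)))
    where
    square : ∀ i → u i * u i ≈ v i * v i
    square i = *-cong (u≋v i) (u≋v i)

  det3-cong : ∀ {A B} → (∀ i j → A i j ≈ B i j) → det3 F A ≈ det3 F B
  det3-cong {A} {B} A≈B =
    +-cong (sub-cong (*-cong (A≈B 0F 0F) (minor 1F 1F 2F 2F)) (*-cong (A≈B 0F 1F) (minor 1F 0F 2F 2F)))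
           (*-cong (A≈B 0F 2F) (minor 1F 0F 2F 1F))
    where
    minor : ∀ i j k l → A i j * A k l - A i l * A k j ≈ B i j * B k l - B i l * B k j
    minor i j k l = sub-cong (*-cong (A≈B i j) (A≈B k l)) (*-cong (A≈B i l) (A≈B k j))

  det3-⊗ : ∀ A B → det3 F (A ⊗ B) ≈ det3 F A * det3 F B
  det3-⊗ A B = solve 18
    (λ a₀₀ a₀₁ a₀₂ a₁₀ a₁₁ a₁₂ a₂₀ a₂₁ a₂₂ b₀₀ b₀₁ b₀₂ b₁₀ b₁₁ b₁₂ b₂₀ b₂₁ b₂₂ →
       let A = ℙ.matrix a₀₀ a₀₁ a₀₂ a₁₀ a₁₁ a₁₂ a₂₀ a₂₁ a₂₂
           B = ℙ.matrix b₀₀ b₀₁ b₀₂ b₁₀ b₁₁ b₁₂ b₂₀ b₂₁ b₂₂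
       in det3 ℙ.R (A ℙ.⊗ B) := det3 ℙ.R A :* det3 ℙ.R B)
    refl (A 0F 0F) (A 0F 1F) (A 0F 2F) (A 1F 0F) (A 1F 1F) (A 1F 2F) (A 2F 0F) (A 2F 1F) (A 2F 2F)
         (B 0F 0F) (B 0F 1F) (B 0F 2F) (B 1F 0F) (B 1F 1F) (B 1F 2F) (B 2F 0F) (B 2F 1F) (B 2F 2F)
    where module ℙ = Symbolic 18

  det3-I₃ : det3 F (I₃ F) ≈ 1#
  det3-I₃ = solve 0 (det3 ℙ.R (I₃ ℙ.R) := con (+ 1)) refl
    where module ℙ = Symbolic 0

  det3-unit : ∀ S → Invertible F S → ∃ λ d → det3 F S * d ≈ 1#
  det3-unit S (T , S⊗T≈I , _) = det3 F T , (begin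
    det3 F S * det3 F T  ≈⟨ det3-⊗ S T ⟨
    det3 F (S ⊗ T)       ≈⟨ det3-cong S⊗T≈I ⟩
    det3 F (I₃ F)        ≈⟨ det3-I₃ ⟩
    1#                   ∎)

  eval-pullback : ∀ E S v → eval F E (S ⊙ v) ≈ eval F (pullback E S) v
  eval-pullback (qform a b c d e f) S v = solve 18
    (λ a b c d e f s₀₀ s₀₁ s₀₂ s₁₀ s₁₁ s₁₂ s₂₀ s₂₁ s₂₂ x y z →
       let E = qform a b c d e f
           S = ℙ.matrix s₀₀ s₀₁ s₀₂ s₁₀ s₁₁ s₁₂ s₂₀ s₂₁ s₂₂
           v = ℙ.vector x y z
       in eval ℙ.R E (S ℙ.⊙ v) := eval ℙ.R (ℙ.pullback E S) v)
    refl a b c d e f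
    (S 0F 0F) (S 0F 1F) (S 0F 2F) (S 1F 0F) (S 1F 1F) (S 1F 2F) (S 2F 0F) (S 2F 1F) (S 2F 2F)
    (v 0F) (v 1F) (v 2F)
    where module ℙ = Symbolic 18

  -- The symmetric matrix of the pullback is Sᵀ M S.
  det3-symMat-pullback : ∀ E S → det3 F (symMat F (pullback E S)) ≈ det3 F S * det3 F S * det3 F (symMat F E)
  det3-symMat-pullback (qform a b c d e f) S = solve 15
    (λ a b c d e f s₀₀ s₀₁ s₀₂ s₁₀ s₁₁ s₁₂ s₂₀ s₂₁ s₂₂ →
       let E = qform a b c d e f
           S = ℙ.matrix s₀₀ s₀₁ s₀₂ s₁₀ s₁₁ s₁₂ s₂₀ s₂₁ s₂₂
       in det3 ℙ.R (symMat ℙ.R (ℙ.pullback E S)) := det3 ℙ.R S :* det3 ℙ.R S :* det3 ℙ.R (symMat ℙ.R E))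
    refl a b c d e f
    (S 0F 0F) (S 0F 1F) (S 0F 2F) (S 1F 0F) (S 1F 1F) (S 1F 2F) (S 2F 0F) (S 2F 1F) (S 2F 2F)
    where module ℙ = Symbolic 15

  mixedCoeff-cong : ∀ {Q Q′} → (∀ v → Q v ≈ Q′ v) → ∀ u w → mixedCoeff F Q u w ≈ mixedCoeff F Q′ u w
  mixedCoeff-cong Q≈Q′ u w = sub-cong (sub-cong (Q≈Q′ _) (Q≈Q′ u)) (Q≈Q′ w)

  Diagonal⇒IsDiagonal : ∀ G → Diagonal F (eval F G) → IsDiagonal G
  Diagonal⇒IsDiagonal (qform a b c d e f) (m₁₂≈0 , m₁₃≈0 , m₂₃≈0) =
    trans (sym m₁₂≈d) m₁₂≈0 , trans (sym m₁₃≈e) m₁₃≈0 , trans (sym m₂₃≈f) m₂₃≈0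
    where
    module ℙ = Symbolic 6
    m₁₂≈d : mixedCoeff F (eval F (qform a b c d e f)) (e₁ F) (e₂ F) ≈ d
    m₁₂≈d = solve 6 (λ a b c d e f → mixedCoeff ℙ.R (eval ℙ.R (qform a b c d e f)) (e₁ ℙ.R) (e₂ ℙ.R) := d)
      refl a b c d e f
    m₁₃≈e : mixedCoeff F (eval F (qform a b c d e f)) (e₁ F) (e₃ F) ≈ e
    m₁₃≈e = solve 6 (λ a b c d e f → mixedCoeff ℙ.R (eval ℙ.R (qform a b c d e f)) (e₁ ℙ.R) (e₃ ℙ.R) := e)
      refl a b c d e f
    m₂₃≈f : mixedCoeff F (eval F (qform a b c d e f)) (e₂ F) (e₃ F) ≈ f
    m₂₃≈f = solve 6 (λ a b c d e f → mixedCoeff ℙ.R (eval ℙ.R (qform a b c d e f)) (e₂ ℙ.R) (e₃ ℙ.R) := f)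
      refl a b c d e f

  pullback-diagonal : ∀ E S → Diagonal F (λ v → eval F E (S ⊙ v)) → IsDiagonal (pullback E S)
  pullback-diagonal E S diagonal = Diagonal⇒IsDiagonal (pullback E S)
    ( transport (e₁ F) (e₂ F) (proj₁ diagonal)
    , transport (e₁ F) (e₃ F) (proj₁ (proj₂ diagonal))
    , transport (e₂ F) (e₃ F) (proj₂ (proj₂ diagonal)))
    where
    transport : ∀ u w → mixedCoeff F (λ v → eval F E (S ⊙ v)) u w ≈ 0# →
                mixedCoeff F (eval F (pullback E S)) u w ≈ 0#
    transport u w m≈0 = trans (sym (mixedCoeff-cong (eval-pullback E S) u w)) m≈0

  unit-cancel : ∀ {u v x} → u * v ≈ 1# → u * u * x ≈ 0# → x ≈ 0#
  unit-cancel {u} {v} {x} u*v≈1 u*u*x≈0 = begin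
    x                          ≈⟨ trans (*-identityˡ _) (*-identityˡ x) ⟨
    1# * (1# * x)              ≈⟨ *-cong (sym u*v≈1) (*-congʳ (sym u*v≈1)) ⟩
    (u * v) * ((u * v) * x)    ≈⟨ solve 3 (λ u v x → (u :* v) :* ((u :* v) :* x) := (v :* v) :* (u :* u :* x))
                                           refl u v x ⟩
    (v * v) * (u * u * x)      ≈⟨ y≈0⇒x*y≈0 (v * v) u*u*x≈0 ⟩
    0#                         ∎

  pullback-proper : ∀ E S → Invertible F S → Proper F E → Proper F (pullback E S)
  pullback-proper E S S-invertible E-proper pullback-degenerate =
    E-proper (unit-cancel (proj₂ (det3-unit S S-invertible))
      (trans (sym (det3-symMat-pullback E S)) pullback-degenerate))

  pullback-meets-once : ∀ E₁ E₂ S → Invertible F S → MeetInExactlyOnePoint F E₁ E₂ →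
                        MeetInExactlyOnePoint F (pullback E₁ S) (pullback E₂ S)
  pullback-meets-once E₁ E₂ S (T , S⊗T≈I , T⊗S≈I) (p , p≉0 , p∈E₁ , p∈E₂ , unique) =
    T ⊙ p , nonzero-⊙ T S STv≋v p≉0 , on-pullback E₁ p∈E₁ , on-pullback E₂ p∈E₂ , unique′
    where
    STv≋v : ∀ v → S ⊙ (T ⊙ v) ≋ v
    STv≋v = ⊙-inverse T S S⊗T≈I

    TSv≋v : ∀ v → T ⊙ (S ⊙ v) ≋ v
    TSv≋v = ⊙-inverse S T T⊗S≈I

    on-pullback : ∀ E → OnConic F E p → OnConic F (pullback E S) (T ⊙ p)
    on-pullback E p∈E = trans (sym (eval-pullback E S (T ⊙ p))) (trans (eval-cong E (STv≋v p)) p∈E)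

    on-original : ∀ E v → OnConic F (pullback E S) v → OnConic F E (S ⊙ v)
    on-original E v v∈pullback = trans (eval-pullback E S v) v∈pullback

    unique′ : ∀ v → ¬ IsZeroVec F v → OnConic F (pullback E₁ S) v → OnConic F (pullback E₂ S) v →
              SamePoint F v (T ⊙ p)
    unique′ v v≉0 v∈P₁ v∈P₂ = SamePoint-congˡ (TSv≋v v) (SamePoint-⊙ T
      (unique (S ⊙ v) (nonzero-⊙ S T TSv≋v v≉0) (on-original E₁ v v∈P₁) (on-original E₂ v v∈P₂)))

  eval-diagonalPart : ∀ {G} → IsDiagonal G → ∀ v → eval F G v ≈ eval F (diagonalPart G) v
  eval-diagonalPart {qform a b c d e f} (d≈0 , e≈0 , f≈0) v =
    +-cong (+-cong (+-congˡ (*-congʳ d≈0)) (*-congʳ e≈0)) (*-congʳ f≈0)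

  symMat-diagonalPart : ∀ {G} → IsDiagonal G → ∀ i j → symMat F G i j ≈ symMat F (diagonalPart G) i j
  symMat-diagonalPart {qform a b c d e f} (d≈0 , e≈0 , f≈0) = λ where
    0F 0F → refl ; 0F 1F → d≈0 ; 0F 2F → e≈0
    1F 0F → d≈0 ; 1F 1F → refl ; 1F 2F → f≈0
    2F 0F → e≈0 ; 2F 1F → f≈0 ; 2F 2F → refl

  det3-symMat-diagonalForm : ∀ a b c → det3 F (symMat F (diagonalForm a b c)) ≈ (a + a) * ((b + b) * (c + c))
  det3-symMat-diagonalForm = solve 3
    (λ a b c → det3 ℙ.R (symMat ℙ.R (ℙ.diagonalForm a b c)) := (a :+ a) :* ((b :+ b) :* (c :+ c))) refl
    where module ℙ = Symbolic 3

  proper-diagonal-coefficients : ∀ a b c d e f → let G = qform a b c d e f in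
    Proper F G → IsDiagonal G → (¬ a ≈ 0#) × (¬ b ≈ 0#) × (¬ c ≈ 0#)
  proper-diagonal-coefficients a b c d e f G-proper G-diagonal =
    x+x≉0⇒x≉0 (x*y≉0⇒x≉0 8abc≉0) ,
    x+x≉0⇒x≉0 (x*y≉0⇒x≉0 (x*y≉0⇒y≉0 8abc≉0)) ,
    x+x≉0⇒x≉0 (x*y≉0⇒y≉0 (x*y≉0⇒y≉0 8abc≉0))
    where
    8abc≉0 : ¬ (a + a) * ((b + b) * (c + c)) ≈ 0#
    8abc≉0 8abc≈0 = G-proper (begin
      det3 F (symMat F (qform a b c d e f))  ≈⟨ det3-cong (symMat-diagonalPart G-diagonal) ⟩
      det3 F (symMat F (diagonalForm a b c)) ≈⟨ det3-symMat-diagonalForm a b c ⟩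
      (a + a) * ((b + b) * (c + c))          ≈⟨ 8abc≈0 ⟩
      0#                                     ∎)

  eval-diagonalForm-negateˣ : ∀ a b c v → eval F (diagonalForm a b c) (negateˣ v) ≈ eval F (diagonalForm a b c) v
  eval-diagonalForm-negateˣ a b c v = solve 6
    (λ a b c x y z → eval ℙ.R (ℙ.diagonalForm a b c) (ℙ.negateˣ (ℙ.vector x y z))
                  := eval ℙ.R (ℙ.diagonalForm a b c) (ℙ.vector x y z))
    refl a b c (v 0F) (v 1F) (v 2F)
    where module ℙ = Symbolic 6

  eval-diagonalForm-negateʸ : ∀ a b c v → eval F (diagonalForm a b c) (negateʸ v) ≈ eval F (diagonalForm a b c) v
  eval-diagonalForm-negateʸ a b c v = solve 6
    (λ a b c x y z → eval ℙ.R (ℙ.diagonalForm a b c) (ℙ.negateʸ (ℙ.vector x y z))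
                  := eval ℙ.R (ℙ.diagonalForm a b c) (ℙ.vector x y z))
    refl a b c (v 0F) (v 1F) (v 2F)
    where module ℙ = Symbolic 6

  negateˣ-nonzero : ∀ v → ¬ IsZeroVec F v → ¬ IsZeroVec F (negateˣ v)
  negateˣ-nonzero v v≉0 -v≈0 = v≉0 λ where
    0F → -x≈0⇒x≈0 (-v≈0 0F) ; 1F → -v≈0 1F ; 2F → -v≈0 2F

  negateʸ-nonzero : ∀ v → ¬ IsZeroVec F v → ¬ IsZeroVec F (negateʸ v)
  negateʸ-nonzero v v≉0 -v≈0 = v≉0 λ where
    0F → -v≈0 0F ; 1F → -x≈0⇒x≈0 (-v≈0 1F) ; 2F → -v≈0 2F

  module _ (isField : IsField F) where

    x≉0∧x*y≈0⇒y≈0 : ∀ {x y} → ¬ x ≈ 0# → x * y ≈ 0# → y ≈ 0#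
    x≉0∧x*y≈0⇒y≈0 {x} {y} x≉0 x*y≈0 = begin
      y                    ≈⟨ *-identityˡ y ⟨
      1# * y               ≈⟨ *-congʳ x*x⁻¹≈1 ⟨
      x * x⁻¹ * y          ≈⟨ solve 3 (λ x x⁻¹ y → x :* x⁻¹ :* y := x⁻¹ :* (x :* y)) refl x x⁻¹ y ⟩
      x⁻¹ * (x * y)        ≈⟨ y≈0⇒x*y≈0 x⁻¹ x*y≈0 ⟩
      0#                   ∎
      where
      x⁻¹ : Carrier
      x⁻¹ = proj₁ (proj₂ isField x x≉0)
      x*x⁻¹≈1 : x * x⁻¹ ≈ 1#
      x*x⁻¹≈1 = proj₂ (proj₂ isField x x≉0)

    x≉0∧y≉0⇒x*y≉0 : ∀ {x y} → ¬ x ≈ 0# → ¬ y ≈ 0# → ¬ x * y ≈ 0#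
    x≉0∧y≉0⇒x*y≉0 x≉0 y≉0 x*y≈0 = y≉0 (x≉0∧x*y≈0⇒y≈0 x≉0 x*y≈0)

    fourth-power-vanishes : ∀ {α β γ x u w} → ¬ α ≈ 0# →
                            α * ((x * x) * (x * x)) + β * (u * u) + γ * (w * w) ≈ 0# →
                            u ≈ 0# → w ≈ 0# → ¬ ¬ x ≈ 0#
    fourth-power-vanishes {α} {β} {γ} {x} {u} {w} α≉0 sum≈0 u≈0 w≈0 x≉0 =
      x≉0∧y≉0⇒x*y≉0 α≉0 (x≉0∧y≉0⇒x*y≉0 x²≉0 x²≉0) (begin
        α * ((x * x) * (x * x))                                 ≈⟨ +-identityʳ _ ⟨
        α * ((x * x) * (x * x)) + 0#                            ≈⟨ +-identityʳ _ ⟨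
        α * ((x * x) * (x * x)) + 0# + 0#                       ≈⟨ +-cong (+-congˡ (square≈0 β u≈0)) (square≈0 γ w≈0) ⟨
        α * ((x * x) * (x * x)) + β * (u * u) + γ * (w * w)     ≈⟨ sum≈0 ⟩
        0#                                                      ∎)
      where
      x²≉0 : ¬ x * x ≈ 0#
      x²≉0 = x≉0∧y≉0⇒x*y≉0 x≉0 x≉0
      square≈0 : ∀ c {y} → y ≈ 0# → c * (y * y) ≈ 0#
      square≈0 c y≈0 = y≈0⇒x*y≈0 c (x≈0⇒x*y≈0 _ y≈0)

    orthogonal-root-is-zero : ∀ {a b c} v → (¬ a ≈ 0#) × (¬ b ≈ 0#) × (¬ c ≈ 0#) →
      eval F (diagonalForm a b c) v ≈ 0# → v 0F * v 1F ≈ 0# → v 0F * v 2F ≈ 0# → v 1F * v 2F ≈ 0# →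
      ¬ ¬ IsZeroVec F v
    orthogonal-root-is-zero {a} {b} {c} v (a≉0 , b≉0 , c≉0) v∈D xy≈0 xz≈0 yz≈0 v≉0 =
      ¬¬x≈0 λ x≈0 → ¬¬y≈0 λ y≈0 → ¬¬z≈0 λ z≈0 → v≉0 λ where
        0F → x≈0 ; 1F → y≈0 ; 2F → z≈0
      where
      module ℙ = Symbolic 6
      x y z : Carrier
      x = v 0F
      y = v 1F
      z = v 2F
      times-root : ∀ t → t * eval F (diagonalForm a b c) v ≈ 0#
      times-root t = y≈0⇒x*y≈0 t v∈D
      ¬¬x≈0 : ¬ ¬ x ≈ 0#
      ¬¬x≈0 = fourth-power-vanishes a≉0 (trans (solve 6 (λ a b c x y z →
        a :* ((x :* x) :* (x :* x)) :+ b :* ((x :* y) :* (x :* y)) :+ c :* ((x :* z) :* (x :* z))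
          := (x :* x) :* eval ℙ.R (ℙ.diagonalForm a b c) (ℙ.vector x y z)) refl a b c x y z) (times-root (x * x)))
        xy≈0 xz≈0
      ¬¬y≈0 : ¬ ¬ y ≈ 0#
      ¬¬y≈0 = fourth-power-vanishes b≉0 (trans (solve 6 (λ a b c x y z →
        b :* ((y :* y) :* (y :* y)) :+ a :* ((x :* y) :* (x :* y)) :+ c :* ((y :* z) :* (y :* z))
          := (y :* y) :* eval ℙ.R (ℙ.diagonalForm a b c) (ℙ.vector x y z)) refl a b c x y z) (times-root (y * y)))
        xy≈0 yz≈0
      ¬¬z≈0 : ¬ ¬ z ≈ 0#
      ¬¬z≈0 = fourth-power-vanishes c≉0 (trans (solve 6 (λ a b c x y z →
        c :* ((z :* z) :* (z :* z)) :+ a :* ((x :* z) :* (x :* z)) :+ b :* ((y :* z) :* (y :* z))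
          := (z :* z) :* eval ℙ.R (ℙ.diagonalForm a b c) (ℙ.vector x y z)) refl a b c x y z) (times-root (z * z)))
        xz≈0 yz≈0

    module _ (odd : OddCharacteristic F) where
      open import Algebra.Properties.Group +-group using (x≈y⇒x∙y⁻¹≈ε)

      opposite-multiple⇒*≈0 : ∀ {x y t} → - x ≈ t * x → y ≈ t * y → x * y ≈ 0#
      opposite-multiple⇒*≈0 {x} {y} {t} -x≈tx y≈ty = x≉0∧x*y≈0⇒y≈0 odd (begin
        (1# + 1#) * (x * y)                     ≈⟨ solve 3 (λ x y t →
          (con (+ 1) :+ con (+ 1)) :* (x :* y) := x :* (y :- t :* y) :+ (t :* x :- (:- x)) :* y) refl x y t ⟩
        x * (y - t * y) + (t * x - (- x)) * y   ≈⟨ +-cong (y≈0⇒x*y≈0 x (x≈y⇒x∙y⁻¹≈ε y≈ty))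
                                                           (x≈0⇒x*y≈0 y (x≈y⇒x∙y⁻¹≈ε (sym -x≈tx))) ⟩
        0# + 0#                                 ≈⟨ +-identityʳ 0# ⟩
        0#                                      ∎)

      diagonal-conics-do-not-meet-once : ∀ G₁ G₂ → Proper F G₁ → IsDiagonal G₁ → IsDiagonal G₂ →
                                         ¬ MeetInExactlyOnePoint F G₁ G₂
      diagonal-conics-do-not-meet-once G₁@(qform a b c′ d e f) G₂ G₁-proper G₁-diagonal G₂-diagonal
        (p , p≉0 , p∈G₁ , p∈G₂ , unique) =
        orthogonal-root-is-zero p (proper-diagonal-coefficients a b c′ d e f G₁-proper G₁-diagonal)
          (trans (sym (eval-diagonalPart G₁-diagonal p)) p∈G₁)
          (opposite-multiple⇒*≈0 (proj₂ negateˣp∼p 0F) (proj₂ negateˣp∼p 1F))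
          (opposite-multiple⇒*≈0 (proj₂ negateˣp∼p 0F) (proj₂ negateˣp∼p 2F))
          (opposite-multiple⇒*≈0 (proj₂ negateʸp∼p 1F) (proj₂ negateʸp∼p 2F))
          p≉0
        where
        Invariant : (Vec3 F → Vec3 F) → Set (c ⊔ ℓ)
        Invariant σ = ∀ a b c v → eval F (diagonalForm a b c) (σ v) ≈ eval F (diagonalForm a b c) v

        on-conic : ∀ σ → Invariant σ → ∀ G → IsDiagonal G → OnConic F G p → OnConic F G (σ p)
        on-conic σ invariant G@(qform a b c _ _ _) G-diagonal p∈G = begin
          eval F G (σ p)                     ≈⟨ eval-diagonalPart G-diagonal (σ p) ⟩
          eval F (diagonalForm a b c) (σ p)  ≈⟨ invariant a b c p ⟩
          eval F (diagonalForm a b c) p      ≈⟨ eval-diagonalPart G-diagonal p ⟨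
          eval F G p                         ≈⟨ p∈G ⟩
          0#                                 ∎

        same-point : ∀ σ → Invariant σ → ¬ IsZeroVec F (σ p) → SamePoint F (σ p) p
        same-point σ invariant σp≉0 = unique (σ p) σp≉0
          (on-conic σ invariant G₁ G₁-diagonal p∈G₁) (on-conic σ invariant G₂ G₂-diagonal p∈G₂)

        negateˣp∼p : SamePoint F (negateˣ p) p
        negateˣp∼p = same-point negateˣ eval-diagonalForm-negateˣ (negateˣ-nonzero p p≉0)

        negateʸp∼p : SamePoint F (negateʸ p) p
        negateʸp∼p = same-point negateʸ eval-diagonalForm-negateʸ (negateʸ-nonzero p p≉0)

mainTheorem9 : {c ℓ : Level} (F : CommutativeRing c ℓ) → IsField F → IsFinite F → OddCharacteristic F →
    (E₁ E₂ : QForm F) → NonZeroForm F E₁ → NonZeroForm F E₂ → Proper F E₁ → Proper F E₂ →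
    MeetInExactlyOnePoint F E₁ E₂ → ¬ SimultaneouslyDiagonalizable F E₁ E₂
mainTheorem9 F isField _ odd E₁ E₂ _ _ E₁-proper _ meet (S , S-invertible , diagonal₁ , diagonal₂) =
  diagonal-conics-do-not-meet-once F isField odd (pullback E₁ S) (pullback E₂ S)
    (pullback-proper F E₁ S S-invertible E₁-proper)
    (pullback-diagonal F E₁ S diagonal₁) (pullback-diagonal F E₂ S diagonal₂)
    (pullback-meets-once F E₁ E₂ S S-invertible meet)
  where open Forms F
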